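{- Let $\mathcal{A}$ be a set of Left dead-ends and let $\mathcal{U}=\mathcal{D}(\mathcal{A})$, a dead-ending universe. Then for every Left dead-end $G$ the following are equivalent: (i) $G\notin\mathrm{up}(\mathcal{A})$; (ii) $G^\circ$ is Left $\mathcal{U}$-strong; (iii) $G^{\circledast}\geq_{\mathcal{U}}0$.
   Context: All games are finite partizan games $\{\mathscr{G}^L\mid\mathscr{G}^R\}$; $G\cong H$ means identical game trees; $0=\{\cdot\mid\cdot\}$, $*=\{0\mid0\}$. Disjunctive sum $G+H=\{G^L+H,G+H^L\mid G^R+H,G+H^R\}$; conjugate $\overline{G}=\{\overline{G^R}\mid\overline{G^L}\}$. Misère outcomes: $o^L(G)=\mathscr{L}$ iff $G$ has no Left option or some $o^R(G^L)=\mathscr{L}$ (else $\mathscr{R}$); $o^R(G)=\mathscr{R}$ iff $G$ has no Right option or some $o^L(G^R)=\mathscr{R}$ (else $\mathscr{L}$); $o(G)=\mathscr{L},\mathscr{N},\mathscr{P},\mathscr{R}$ for $(o^L,o^R)=(\mathscr{L},\mathscr{L}),(\mathscr{L},\mathscr{R}),(\mathscr{R},\mathscr{L}),(\mathscr{R},\mathscr{R})$, ordered $\mathscr{L}>\mathscr{N}>\mathscr{R}$, $\mathscr{L}>\mathscr{P}>\mathscr{R}$. A universe is a set of games closed under options, sums, conjugates, and forming $\{\mathscr{S}\mid\mathscr{T}\}$ for nonempty finite subsets $\mathscr{S},\mathscr{T}$; $\mathcal{D}(\mathcal{A})$ is the smallest universe containing $\mathcal{A}$. For a set $\mathcal{U}$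 and arbitrary games, $G\geq_{\mathcal{U}}H$ iff $o(G+X)\geq o(H+X)$ for all $X\in\mathcal{U}$. A Left end has no Left option; a Left dead-end is a game all of whose subpositions are Left ends. A game is dead-ending if each subposition that is a Left end is a Left dead-end and each subposition that is a Right end (no Right option) is a Right dead-end; a universe is dead-ending if all its games are. $G$ is Left $\mathcal{U}$-strong if $o(G+X)\geq\mathscr{N}$ for every Left end $X\in\mathcal{U}$. $\mathrm{cl}(\mathcal{A})$ is the smallest set containing $\mathcal{A}$ closed under taking options and disjunctive sums. For Left dead-ends, $G\geq H$ means $G\geq_{\mathcal{M}}H$ ($\mathcal{M}$ = all games). $\mathrm{up}(\mathcal{A})=\{G \text{ Left dead-end}: G\geq H \text{ for some } H\in\mathrm{cl}(\mathcal{A})\}$. For a Left dead-end $G$: the adjoint is $G^\circ=*$ if $G\cong0$, and $G^\circ=\{(G^R)^\circ\mid 0\}$ otherwise ($G^R$ ranging over Right options of $G$); the Left-modified adjoint is $G^{\circledast}=\{0\mid *\}$ if $G\cong0$, and $G^{\circledast}=\{(G^R)^\circ\mid *\}$ otherwise. -}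

module Defs where

open import Data.Bool using (Bool; true; false; not; _∨_; _∧_)
open import Data.List using (List; []; _∷_; _++_)
open import Data.List.Membership.Propositional using (_∈_)
open import Data.List.Relation.Unary.All using (All)
open import Data.Unit using (⊤)
open import Data.Product using (Σ; _×_)
open import Relation.Binary.PropositionalEquality using (_≡_)

-- Finite partizan games {G^L | G^R}; option sets are given as finite lists
-- (order / multiplicity are irrelevant for everything below).

data Game : Set where
  ⟨_∣_⟩ : List Game → List Game → Game

zeroG : Game
zeroG = ⟨ [] ∣ [] ⟩

star : Game
star = ⟨ zeroG ∷ [] ∣ zeroG ∷ [] ⟩

mutual
  _+G_ : Game → Game → Game
  G@(⟨ GL ∣ GR ⟩) +G H@(⟨ HL ∣ HR ⟩) =
    ⟨ addˡ GL H ++ addʳ G HL ∣ addˡ GR H ++ addʳ G HR ⟩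

  addˡ : List Game → Game → List Game
  addˡ []       H = []
  addˡ (g ∷ gs) H = (g +G H) ∷ addˡ gs H

  addʳ : Game → List Game → List Game
  addʳ G []       = []
  addʳ G (h ∷ hs) = (G +G h) ∷ addʳ G hs

mutual
  conj : Game → Game
  conj ⟨ GL ∣ GR ⟩ = ⟨ conjs GR ∣ conjs GL ⟩

  conjs : List Game → List Game
  conjs []       = []
  conjs (g ∷ gs) = conj g ∷ conjs gs

-- Misère outcomes.
-- oLeft G  = true  iff  o^L(G) = 𝓛   (Left, moving first, wins)
-- oRight G = true  iff  o^R(G) = 𝓡   (Right, moving first, wins)

mutual
  oLeft : Game → Bool
  oLeft ⟨ [] ∣ GR ⟩       = true
  oLeft ⟨ g ∷ gs ∣ GR ⟩   = someRightLoses (g ∷ gs)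

  oRight : Game → Bool
  oRight ⟨ GL ∣ [] ⟩      = true
  oRight ⟨ GL ∣ g ∷ gs ⟩  = someLeftLoses (g ∷ gs)

  someRightLoses : List Game → Bool
  someRightLoses []       = false
  someRightLoses (g ∷ gs) = not (oRight g) ∨ someRightLoses gs

  someLeftLoses : List Game → Bool
  someLeftLoses []       = false
  someLeftLoses (g ∷ gs) = not (oLeft g) ∨ someLeftLoses gs

data Outcome : Set where
  𝓛 𝓝 𝓟 𝓡 : Outcome

outcomeOf : Bool → Bool → Outcome
outcomeOf true  false = 𝓛
outcomeOf true  true  = 𝓝
outcomeOf false false = 𝓟
outcomeOf false true  = 𝓡

o : Game → Outcome
o G = outcomeOf (oLeft G) (oRight G)

data _≥o_ : Outcome → Outcome → Set where
  ≥o-refl : ∀ {x} → x ≥o x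
  𝓛≥𝓝 : 𝓛 ≥o 𝓝
  𝓛≥𝓟 : 𝓛 ≥o 𝓟
  𝓛≥𝓡 : 𝓛 ≥o 𝓡
  𝓝≥𝓡 : 𝓝 ≥o 𝓡
  𝓟≥𝓡 : 𝓟 ≥o 𝓡

_≥[_]_ : Game → (Game → Set) → Game → Set
G ≥[ U ] H = ∀ X → U X → o (G +G X) ≥o o (H +G X)

𝓜 : Game → Set
𝓜 _ = ⊤

LeftEnd : Game → Set
LeftEnd ⟨ GL ∣ GR ⟩ = GL ≡ []

RightEnd : Game → Set
RightEnd ⟨ GL ∣ GR ⟩ = GR ≡ []

data Subpos : Game → Game → Set where
  here   : ∀ {G} → Subpos G G
  viaL   : ∀ {H g GL GR} → g ∈ GL → Subpos H g → Subpos H ⟨ GL ∣ GR ⟩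
  viaR   : ∀ {H g GL GR} → g ∈ GR → Subpos H g → Subpos H ⟨ GL ∣ GR ⟩

LeftDeadEnd : Game → Set
LeftDeadEnd G = ∀ H → Subpos H G → LeftEnd H

data 𝒟 (A : Game → Set) : Game → Set where
  base   : ∀ {G} → A G → 𝒟 A G
  optL   : ∀ {g GL GR} → 𝒟 A ⟨ GL ∣ GR ⟩ → g ∈ GL → 𝒟 A g
  optR   : ∀ {g GL GR} → 𝒟 A ⟨ GL ∣ GR ⟩ → g ∈ GR → 𝒟 A g
  sum    : ∀ {G H} → 𝒟 A G → 𝒟 A H → 𝒟 A (G +G H)
  conjug : ∀ {G} → 𝒟 A G → 𝒟 A (conj G)
  form   : ∀ {s ss t ts} → All (𝒟 A) (s ∷ ss) → All (𝒟 A) (t ∷ ts) →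
           𝒟 A ⟨ s ∷ ss ∣ t ∷ ts ⟩

data cl (A : Game → Set) : Game → Set where
  base : ∀ {G} → A G → cl A G
  optL : ∀ {g GL GR} → cl A ⟨ GL ∣ GR ⟩ → g ∈ GL → cl A g
  optR : ∀ {g GL GR} → cl A ⟨ GL ∣ GR ⟩ → g ∈ GR → cl A g
  sum  : ∀ {G H} → cl A G → cl A H → cl A (G +G H)

up : (Game → Set) → Game → Set
up A G = LeftDeadEnd G × Σ Game (λ H → cl A H × (G ≥[ 𝓜 ] H))

LeftStrong : (Game → Set) → Game → Set
LeftStrong U G = ∀ X → U X → LeftEnd X → o (G +G X) ≥o 𝓝

mutual
  adj : Game → Game
  adj ⟨ [] ∣ [] ⟩           = star
  adj ⟨ [] ∣ r ∷ rs ⟩       = ⟨ adjs (r ∷ rs) ∣ zeroG ∷ [] ⟩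
  adj ⟨ l ∷ ls ∣ GR ⟩       = ⟨ adjs GR ∣ zeroG ∷ [] ⟩

  adjs : List Game → List Game
  adjs []       = []
  adjs (g ∷ gs) = adj g ∷ adjs gs

ladj : Game → Game
ladj ⟨ [] ∣ [] ⟩     = ⟨ zeroG ∷ [] ∣ star ∷ [] ⟩
ladj ⟨ [] ∣ r ∷ rs ⟩ = ⟨ adjs (r ∷ rs) ∣ star ∷ [] ⟩
ladj ⟨ l ∷ ls ∣ GR ⟩ = ⟨ adjs GR ∣ star ∷ [] ⟩

-- Left loses G + G° moving first: Right answers a move to G + (G^R)° by moving to G^R + (G^R)°.
-- Conversely, if Left loses G° + X for a Left dead-end X, then G ≥ X: a winning Right move
-- G → G^R in G + Y is mirrored by the move X → X^R that answers Left's move G° → (G^R)° in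
-- G° + X, while X, being a Left end, gives Left nothing beyond Y.  When 𝒜 consists of Left
-- dead-ends, every Left end of 𝒟(𝒜) lies in cl(𝒜), so G° fails to be Left strong exactly when
-- G ≥ H for some H ∈ cl(𝒜).  Finally G⊛ has
-- the Left options of G° and Right's only move G⊛ → * is refuted by Left's reply * → 0, which
-- turns G⊛ ≥ 0 into Left strength of G°.

module Submission where

open import Defs
open import Data.Bool using (Bool; true; false; not; _∨_)
open import Data.Bool.Properties using (¬-not; not-¬; ⇔→≡; ∨-zeroʳ)
open import Data.Empty using (⊥; ⊥-elim)
open import Data.List using (List; []; _∷_; _++_; map)
open import Data.List.Membership.Propositional using (_∈_)
open import Data.List.Membership.Propositional.Properties using (∈-++⁺ˡ; ∈-++⁺ʳ; ∈-++⁻; ∈-map⁺; ∈-map⁻)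
open import Data.List.Relation.Unary.Any using (here; there)
open import Data.List.Relation.Unary.All using (All; []; _∷_; lookup)
open import Data.List.Relation.Unary.All.Properties using (++⁺)
open import Data.Product using (_×_; _,_; proj₁; proj₂; ∃-syntax)
open import Data.Sum using (_⊎_; inj₁; inj₂)
open import Data.Unit using (tt)
open import Function.Base using (const; _∘_; case_of_)
open import Function.Bundles using (_⇔_; mk⇔; module Equivalence)
open import Relation.Nullary using (¬_)
open import Relation.Binary.PropositionalEquality using (_≡_; refl; sym; trans; cong; cong₂; subst; subst₂)

open Equivalence using (to; from)

private variable
  G H X g h x : Game
  GL GR HL HR XR L R xs : List Game

mutual
  Game-ind : (P : Game → Set) →
             (∀ GL GR → All P GL → All P GR → P ⟨ GL ∣ GR ⟩) → ∀ G → P G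
  Game-ind P step ⟨ GL ∣ GR ⟩ = step GL GR (Game-indˢ P step GL) (Game-indˢ P step GR)

  Game-indˢ : (P : Game → Set) →
              (∀ GL GR → All P GL → All P GR → P ⟨ GL ∣ GR ⟩) → ∀ gs → All P gs
  Game-indˢ P step []       = []
  Game-indˢ P step (g ∷ gs) = Game-ind P step g ∷ Game-indˢ P step gs

contraposeᵇ : ∀ {a b u v : Bool} → (a ≡ u → b ≡ v) → b ≡ not v → a ≡ not u
contraposeᵇ f b≡¬v = ¬-not (λ a≡u → not-¬ (f a≡u) b≡¬v)

_⊒_ : Game → Game → Set
G ⊒ H = (oLeft H ≡ true → oLeft G ≡ true) × (oRight G ≡ true → oRight H ≡ true)

outcomeOf-mono : ∀ a₁ a₂ b₁ b₂ → (b₁ ≡ true → a₁ ≡ true) → (a₂ ≡ true → b₂ ≡ true) →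
                 outcomeOf a₁ a₂ ≥o outcomeOf b₁ b₂
outcomeOf-mono false _     true  _     f _ with () ← f refl
outcomeOf-mono _     true  _     false _ g with () ← g refl
outcomeOf-mono true  false true  false _ _ = ≥o-refl
outcomeOf-mono true  false true  true  _ _ = 𝓛≥𝓝
outcomeOf-mono true  false false false _ _ = 𝓛≥𝓟
outcomeOf-mono true  false false true  _ _ = 𝓛≥𝓡
outcomeOf-mono true  true  true  true  _ _ = ≥o-refl
outcomeOf-mono true  true  false true  _ _ = 𝓝≥𝓡
outcomeOf-mono false false false false _ _ = ≥o-refl
outcomeOf-mono false false false true  _ _ = 𝓟≥𝓡
outcomeOf-mono false true  false true  _ _ = ≥o-refl

leftWins rightWins : Outcome → Bool
leftWins 𝓛 = true
leftWins 𝓝 = true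
leftWins _ = false
rightWins 𝓝 = true
rightWins 𝓡 = true
rightWins _ = false

leftWins-o : ∀ G → leftWins (o G) ≡ oLeft G
leftWins-o G with oLeft G | oRight G
... | true  | false = refl
... | true  | true  = refl
... | false | false = refl
... | false | true  = refl

rightWins-o : ∀ G → rightWins (o G) ≡ oRight G
rightWins-o G with oLeft G | oRight G
... | true  | false = refl
... | true  | true  = refl
... | false | false = refl
... | false | true  = refl

≥o-leftWins : ∀ {u v} → u ≥o v → leftWins v ≡ true → leftWins u ≡ true
≥o-leftWins ≥o-refl = λ w → w
≥o-leftWins 𝓛≥𝓝    = const refl
≥o-leftWins 𝓛≥𝓟    = const refl
≥o-leftWins 𝓛≥𝓡    = const refl
≥o-leftWins 𝓝≥𝓡    = λ ()
≥o-leftWins 𝓟≥𝓡    = λ ()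

≥o-rightWins : ∀ {u v} → u ≥o v → rightWins u ≡ true → rightWins v ≡ true
≥o-rightWins ≥o-refl = λ w → w
≥o-rightWins 𝓛≥𝓝    = λ ()
≥o-rightWins 𝓛≥𝓟    = λ ()
≥o-rightWins 𝓛≥𝓡    = λ ()
≥o-rightWins 𝓝≥𝓡    = const refl
≥o-rightWins 𝓟≥𝓡    = λ ()

≥o⇔⊒ : ∀ G H → o G ≥o o H ⇔ G ⊒ H
≥o⇔⊒ G H = mk⇔
  (λ p → (λ w → trans (sym (leftWins-o G)) (≥o-leftWins p (trans (leftWins-o H) w)))
       , (λ w → trans (sym (rightWins-o H)) (≥o-rightWins p (trans (rightWins-o G) w))))
  (λ (l , r) → outcomeOf-mono (oLeft G) (oRight G) (oLeft H) (oRight H) l r)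

≥𝓝⇔oLeft : ∀ G → o G ≥o 𝓝 ⇔ oLeft G ≡ true
≥𝓝⇔oLeft G = mk⇔ (λ p → trans (sym (leftWins-o G)) (≥o-leftWins p refl))
                    (λ w → outcomeOf-mono (oLeft G) (oRight G) true true (const w) (const refl))

someRightLoses-intro : x ∈ xs → oRight x ≡ false → someRightLoses xs ≡ true
someRightLoses-intro (here refl) e rewrite e = refl
someRightLoses-intro {xs = y ∷ _} (there m) e =
  trans (cong (not (oRight y) ∨_) (someRightLoses-intro m e)) (∨-zeroʳ _)

someRightLoses-true⁻ : someRightLoses xs ≡ true → ∃[ x ] x ∈ xs × oRight x ≡ false
someRightLoses-true⁻ {y ∷ _} w with oRight y in eq
... | false = y , here refl , eq
... | true  = let x , m , q = someRightLoses-true⁻ w in x , there m , q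

someLeftLoses-intro : x ∈ xs → oLeft x ≡ false → someLeftLoses xs ≡ true
someLeftLoses-intro (here refl) e rewrite e = refl
someLeftLoses-intro {xs = y ∷ _} (there m) e =
  trans (cong (not (oLeft y) ∨_) (someLeftLoses-intro m e)) (∨-zeroʳ _)

someLeftLoses-true⁻ : someLeftLoses xs ≡ true → ∃[ x ] x ∈ xs × oLeft x ≡ false
someLeftLoses-true⁻ {y ∷ _} w with oLeft y in eq
... | false = y , here refl , eq
... | true  = let x , m , q = someLeftLoses-true⁻ w in x , there m , q

oLeft-move : x ∈ L → oRight x ≡ false → oLeft ⟨ L ∣ R ⟩ ≡ true
oLeft-move {L = _ ∷ _} = someRightLoses-intro

oLeft-true⁻ : oLeft ⟨ L ∣ R ⟩ ≡ true → L ≡ [] ⊎ ∃[ x ] x ∈ L × oRight x ≡ false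
oLeft-true⁻ {L = []}    _ = inj₁ refl
oLeft-true⁻ {L = _ ∷ _} w = inj₂ (someRightLoses-true⁻ w)

oLeft-end : LeftEnd G → oLeft G ≡ true
oLeft-end {⟨ [] ∣ _ ⟩} refl = refl

oLeft-ignoresʳ : ∀ L R R′ → oLeft ⟨ L ∣ R ⟩ ≡ oLeft ⟨ L ∣ R′ ⟩
oLeft-ignoresʳ []      _ _ = refl
oLeft-ignoresʳ (_ ∷ _) _ _ = refl

oRight-move : x ∈ R → oLeft x ≡ false → oRight ⟨ L ∣ R ⟩ ≡ true
oRight-move {R = _ ∷ _} = someLeftLoses-intro

oRight-true⁻ : oRight ⟨ L ∣ R ⟩ ≡ true → R ≡ [] ⊎ ∃[ x ] x ∈ R × oLeft x ≡ false
oRight-true⁻ {R = []}    _ = inj₁ refl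
oRight-true⁻ {R = _ ∷ _} w = inj₂ (someLeftLoses-true⁻ w)

oRight-end : RightEnd G → oRight G ≡ true
oRight-end {⟨ _ ∣ [] ⟩} refl = refl

addˡ≡map : ∀ gs H → addˡ gs H ≡ map (_+G H) gs
addˡ≡map []       H = refl
addˡ≡map (g ∷ gs) H = cong (g +G H ∷_) (addˡ≡map gs H)

addʳ≡map : ∀ G hs → addʳ G hs ≡ map (G +G_) hs
addʳ≡map G []       = refl
addʳ≡map G (h ∷ hs) = cong (G +G h ∷_) (addʳ≡map G hs)

∈-addˡ⁺ : g ∈ xs → g +G H ∈ addˡ xs H
∈-addˡ⁺ {xs = xs} {H} m rewrite addˡ≡map xs H = ∈-map⁺ (_+G H) m

∈-addʳ⁺ : h ∈ xs → G +G h ∈ addʳ G xs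
∈-addʳ⁺ {xs = xs} {G} m rewrite addʳ≡map G xs = ∈-map⁺ (G +G_) m

∈-addˡ⁻ : x ∈ addˡ xs H → ∃[ g ] g ∈ xs × x ≡ g +G H
∈-addˡ⁻ {xs = xs} {H} m rewrite addˡ≡map xs H = ∈-map⁻ (_+G H) m

∈-addʳ⁻ : x ∈ addʳ G xs → ∃[ h ] h ∈ xs × x ≡ G +G h
∈-addʳ⁻ {G = G} {xs} m rewrite addʳ≡map G xs = ∈-map⁻ (G +G_) m

LeftEnd-+ : LeftEnd G → LeftEnd H → LeftEnd (G +G H)
LeftEnd-+ {⟨ [] ∣ _ ⟩} {⟨ [] ∣ _ ⟩} refl refl = refl

RightEnd-+ : RightEnd G → RightEnd H → RightEnd (G +G H)
RightEnd-+ {⟨ _ ∣ [] ⟩} {⟨ _ ∣ [] ⟩} refl refl = refl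

LeftEnd-+⁻ : LeftEnd (G +G H) → LeftEnd G × LeftEnd H
LeftEnd-+⁻ {⟨ [] ∣ _ ⟩} {⟨ [] ∣ _ ⟩} refl = refl , refl

RightEnd-+⁻ : RightEnd (G +G H) → RightEnd G × RightEnd H
RightEnd-+⁻ {⟨ _ ∣ [] ⟩} {⟨ _ ∣ [] ⟩} refl = refl , refl

oLeft-+-moveˡ : ∀ H → g ∈ GL → oRight (g +G H) ≡ false → oLeft (⟨ GL ∣ GR ⟩ +G H) ≡ true
oLeft-+-moveˡ ⟨ _ ∣ _ ⟩ m = oLeft-move (∈-++⁺ˡ (∈-addˡ⁺ m))

oLeft-+-moveʳ : ∀ G → h ∈ HL → oRight (G +G h) ≡ false → oLeft (G +G ⟨ HL ∣ HR ⟩) ≡ true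
oLeft-+-moveʳ ⟨ GL ∣ _ ⟩ m = oLeft-move (∈-++⁺ʳ (addˡ GL _) (∈-addʳ⁺ m))

oRight-+-moveˡ : ∀ H → g ∈ GR → oLeft (g +G H) ≡ false → oRight (⟨ GL ∣ GR ⟩ +G H) ≡ true
oRight-+-moveˡ ⟨ _ ∣ _ ⟩ m = oRight-move (∈-++⁺ˡ (∈-addˡ⁺ m))

oRight-+-moveʳ : ∀ G → h ∈ HR → oLeft (G +G h) ≡ false → oRight (G +G ⟨ HL ∣ HR ⟩) ≡ true
oRight-+-moveʳ ⟨ _ ∣ GR ⟩ m = oRight-move (∈-++⁺ʳ (addˡ GR _) (∈-addʳ⁺ m))

oLeft-+-false⁻ˡ : ∀ H → oLeft (⟨ GL ∣ GR ⟩ +G H) ≡ false → g ∈ GL → oRight (g +G H) ≡ true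
oLeft-+-false⁻ˡ H lost m = contraposeᵇ (oLeft-+-moveˡ H m) lost

oLeft-+-true⁻ : let G = ⟨ GL ∣ GR ⟩; H = ⟨ HL ∣ HR ⟩ in
  oLeft (G +G H) ≡ true →
  (GL ≡ [] × HL ≡ []) ⊎ (∃[ g ] g ∈ GL × oRight (g +G H) ≡ false)
                      ⊎ (∃[ h ] h ∈ HL × oRight (G +G h) ≡ false)
oLeft-+-true⁻ {GL} w with oLeft-true⁻ w
... | inj₁ e = inj₁ (LeftEnd-+⁻ e)
... | inj₂ (_ , m , q) with ∈-++⁻ (addˡ GL _) m
...   | inj₁ mˡ with g , mg , refl ← ∈-addˡ⁻ mˡ = inj₂ (inj₁ (g , mg , q))
...   | inj₂ mʳ with h , mh , refl ← ∈-addʳ⁻ mʳ = inj₂ (inj₂ (h , mh , q))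

oRight-+-true⁻ : let G = ⟨ GL ∣ GR ⟩; H = ⟨ HL ∣ HR ⟩ in
  oRight (G +G H) ≡ true →
  (GR ≡ [] × HR ≡ []) ⊎ (∃[ g ] g ∈ GR × oLeft (g +G H) ≡ false)
                      ⊎ (∃[ h ] h ∈ HR × oLeft (G +G h) ≡ false)
oRight-+-true⁻ {GR = GR} w with oRight-true⁻ w
... | inj₁ e = inj₁ (RightEnd-+⁻ e)
... | inj₂ (_ , m , q) with ∈-++⁻ (addˡ GR _) m
...   | inj₁ mˡ with g , mg , refl ← ∈-addˡ⁻ mˡ = inj₂ (inj₁ (g , mg , q))
...   | inj₂ mʳ with h , mh , refl ← ∈-addʳ⁻ mʳ = inj₂ (inj₂ (h , mh , q))

mutual
  +G-identityˡ : ∀ G → zeroG +G G ≡ G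
  +G-identityˡ ⟨ GL ∣ GR ⟩ = cong₂ ⟨_∣_⟩ (addʳ-identityˡ GL) (addʳ-identityˡ GR)

  addʳ-identityˡ : ∀ hs → addʳ zeroG hs ≡ hs
  addʳ-identityˡ []       = refl
  addʳ-identityˡ (h ∷ hs) = cong₂ _∷_ (+G-identityˡ h) (addʳ-identityˡ hs)

oLeft[*+X]≡false⇒oRight : oLeft (star +G X) ≡ false → oRight X ≡ true
oLeft[*+X]≡false⇒oRight {X} lost = subst (λ Z → oRight Z ≡ true) (+G-identityˡ X)
  (oLeft-+-false⁻ˡ {GL = zeroG ∷ []} {GR = zeroG ∷ []} X lost (here refl))

oLeft-+-swap : let G = ⟨ GL ∣ GR ⟩; H = ⟨ HL ∣ HR ⟩ in
  (∀ {g} → g ∈ GL → oRight (g +G H) ≡ oRight (H +G g)) →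
  (∀ {h} → h ∈ HL → oRight (G +G h) ≡ oRight (h +G G)) →
  oLeft (G +G H) ≡ true → oLeft (H +G G) ≡ true
oLeft-+-swap {GL} {GR} {HL} {HR} commˡ commʳ w
  with oLeft-+-true⁻ {GL} {GR} {HL} {HR} w
... | inj₁ (refl , refl)        = refl
... | inj₂ (inj₁ (_ , m , q)) = oLeft-+-moveʳ ⟨ HL ∣ HR ⟩ m (trans (sym (commˡ m)) q)
... | inj₂ (inj₂ (_ , m , q)) = oLeft-+-moveˡ ⟨ GL ∣ GR ⟩ m (trans (sym (commʳ m)) q)

oRight-+-swap : let G = ⟨ GL ∣ GR ⟩; H = ⟨ HL ∣ HR ⟩ in
  (∀ {g} → g ∈ GR → oLeft (g +G H) ≡ oLeft (H +G g)) →
  (∀ {h} → h ∈ HR → oLeft (G +G h) ≡ oLeft (h +G G)) →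
  oRight (G +G H) ≡ true → oRight (H +G G) ≡ true
oRight-+-swap {GL} {GR} {HL} {HR} commˡ commʳ w
  with oRight-+-true⁻ {GL} {GR} {HL} {HR} w
... | inj₁ (refl , refl)        = refl
... | inj₂ (inj₁ (_ , m , q)) = oRight-+-moveʳ ⟨ HL ∣ HR ⟩ m (trans (sym (commˡ m)) q)
... | inj₂ (inj₂ (_ , m , q)) = oRight-+-moveˡ ⟨ GL ∣ GR ⟩ m (trans (sym (commʳ m)) q)

OutcomesCommute : Game → Game → Set
OutcomesCommute G H = oLeft (G +G H) ≡ oLeft (H +G G) × oRight (G +G H) ≡ oRight (H +G G)

+G-outcomes-comm : ∀ G H → OutcomesCommute G H
+G-outcomes-comm = Game-ind (λ G → ∀ H → OutcomesCommute G H) λ GL GR ihL ihR →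
  Game-ind (OutcomesCommute ⟨ GL ∣ GR ⟩) λ HL HR jhL jhR →
    let ihL′ = λ {g} (m : g ∈ GL) → lookup ihL m ⟨ HL ∣ HR ⟩
        ihR′ = λ {g} (m : g ∈ GR) → lookup ihR m ⟨ HL ∣ HR ⟩
    in ⇔→≡ (mk⇔ (oLeft-+-swap (proj₂ ∘ ihL′) (proj₂ ∘ lookup jhL))
                (oLeft-+-swap (sym ∘ proj₂ ∘ lookup jhL) (sym ∘ proj₂ ∘ ihL′)))
     , ⇔→≡ (mk⇔ (oRight-+-swap (proj₁ ∘ ihR′) (proj₁ ∘ lookup jhR))
                (oRight-+-swap (sym ∘ proj₁ ∘ lookup jhR) (sym ∘ proj₁ ∘ ihR′)))

conjs-++ : ∀ xs ys → conjs (xs ++ ys) ≡ conjs xs ++ conjs ys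
conjs-++ []       ys = refl
conjs-++ (x ∷ xs) ys = cong (conj x ∷_) (conjs-++ xs ys)

mutual
  conj-+G : ∀ G H → conj (G +G H) ≡ conj G +G conj H
  conj-+G G@(⟨ GL ∣ GR ⟩) H@(⟨ HL ∣ HR ⟩) = cong₂ ⟨_∣_⟩
    (trans (conjs-++ (addˡ GR H) (addʳ G HR)) (cong₂ _++_ (conjs-addˡ GR H) (conjs-addʳ G HR)))
    (trans (conjs-++ (addˡ GL H) (addʳ G HL)) (cong₂ _++_ (conjs-addˡ GL H) (conjs-addʳ G HL)))

  conjs-addˡ : ∀ gs H → conjs (addˡ gs H) ≡ addˡ (conjs gs) (conj H)
  conjs-addˡ []       H = refl
  conjs-addˡ (g ∷ gs) H = cong₂ _∷_ (conj-+G g H) (conjs-addˡ gs H)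

  conjs-addʳ : ∀ G hs → conjs (addʳ G hs) ≡ addʳ (conj G) (conjs hs)
  conjs-addʳ G []       = refl
  conjs-addʳ G (h ∷ hs) = cong₂ _∷_ (conj-+G G h) (conjs-addʳ G hs)

mutual
  conj-involutive : ∀ G → conj (conj G) ≡ G
  conj-involutive ⟨ GL ∣ GR ⟩ = cong₂ ⟨_∣_⟩ (conjs-involutive GL) (conjs-involutive GR)

  conjs-involutive : ∀ gs → conjs (conjs gs) ≡ gs
  conjs-involutive []       = refl
  conjs-involutive (g ∷ gs) = cong₂ _∷_ (conj-involutive g) (conjs-involutive gs)

conjs≡[]⁻ : conjs xs ≡ [] → xs ≡ []
conjs≡[]⁻ {[]} _ = refl

data Hereditary (P : Game → Set) : Game → Set where
  hereditary : P ⟨ GL ∣ GR ⟩ → All (Hereditary P) GL → All (Hereditary P) GR →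
               Hereditary P ⟨ GL ∣ GR ⟩

module _ {P : Game → Set} where

  Hereditary-here : Hereditary P G → P G
  Hereditary-here (hereditary p _ _) = p

  Hereditary-optL : Hereditary P ⟨ GL ∣ GR ⟩ → g ∈ GL → Hereditary P g
  Hereditary-optL (hereditary _ hL _) = lookup hL

  Hereditary-optR : Hereditary P ⟨ GL ∣ GR ⟩ → g ∈ GR → Hereditary P g
  Hereditary-optR (hereditary _ _ hR) = lookup hR

  module _ (P-+ : ∀ {G H} → P G → P H → P (G +G H)) where
    mutual
      Hereditary-+ : Hereditary P G → Hereditary P H → Hereditary P (G +G H)
      Hereditary-+ hG@(hereditary pG hGL hGR) hH@(hereditary pH hHL hHR) =
        hereditary (P-+ pG pH) (++⁺ (Hereditary-addˡ hGL hH) (Hereditary-addʳ hG hHL))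
                               (++⁺ (Hereditary-addˡ hGR hH) (Hereditary-addʳ hG hHR))

      Hereditary-addˡ : All (Hereditary P) xs → Hereditary P H → All (Hereditary P) (addˡ xs H)
      Hereditary-addˡ []         hH = []
      Hereditary-addˡ (hg ∷ hgs) hH = Hereditary-+ hg hH ∷ Hereditary-addˡ hgs hH

      Hereditary-addʳ : Hereditary P G → All (Hereditary P) xs → All (Hereditary P) (addʳ G xs)
      Hereditary-addʳ hG []         = []
      Hereditary-addʳ hG (hh ∷ hhs) = Hereditary-+ hG hh ∷ Hereditary-addʳ hG hhs

  module _ (P-conj : ∀ {G} → P G → P (conj G)) where
    mutual
      Hereditary-conj : Hereditary P G → Hereditary P (conj G)
      Hereditary-conj (hereditary p hL hR) = hereditary (P-conj p) (Hereditary-conjs hR) (Hereditary-conjs hL)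

      Hereditary-conjs : All (Hereditary P) xs → All (Hereditary P) (conjs xs)
      Hereditary-conjs []       = []
      Hereditary-conjs (h ∷ hs) = Hereditary-conj h ∷ Hereditary-conjs hs

LeftDeadEndᴴ : Game → Set
LeftDeadEndᴴ = Hereditary LeftEnd

mutual
  LeftDeadEnd⇒ᴴ : ∀ G → LeftDeadEnd G → LeftDeadEndᴴ G
  LeftDeadEnd⇒ᴴ ⟨ GL ∣ GR ⟩ d =
    hereditary (d _ here) (LeftDeadEnds⇒ᴴ GL (λ m H s → d H (viaL m s)))
                          (LeftDeadEnds⇒ᴴ GR (λ m H s → d H (viaR m s)))

  LeftDeadEnds⇒ᴴ : ∀ xs → (∀ {x} → x ∈ xs → LeftDeadEnd x) → All LeftDeadEndᴴ xs
  LeftDeadEnds⇒ᴴ []       d = []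
  LeftDeadEnds⇒ᴴ (x ∷ xs) d = LeftDeadEnd⇒ᴴ x (d (here refl)) ∷ LeftDeadEnds⇒ᴴ xs (d ∘ there)

cl⊆𝒟 : ∀ {A} → cl A G → 𝒟 A G
cl⊆𝒟 (base a)   = base a
cl⊆𝒟 (optL c m) = optL (cl⊆𝒟 c) m
cl⊆𝒟 (optR c m) = optR (cl⊆𝒟 c) m
cl⊆𝒟 (sum c d)  = sum (cl⊆𝒟 c) (cl⊆𝒟 d)

-- The clause for Right ends is what makes the invariant survive conjugation.
EndsInCl : (Game → Set) → Game → Set
EndsInCl A G = (LeftEnd G → cl A G) × (RightEnd G → cl A (conj G))

module _ {A : Game → Set} (A-dead : ∀ G → A G → LeftDeadEnd G) where

  cl⇒LeftDeadEndᴴ : cl A G → LeftDeadEndᴴ G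
  cl⇒LeftDeadEndᴴ (base a)   = LeftDeadEnd⇒ᴴ _ (A-dead _ a)
  cl⇒LeftDeadEndᴴ (optL c m) = Hereditary-optL (cl⇒LeftDeadEndᴴ c) m
  cl⇒LeftDeadEndᴴ (optR c m) = Hereditary-optR (cl⇒LeftDeadEndᴴ c) m
  cl⇒LeftDeadEndᴴ (sum c d)  = Hereditary-+ LeftEnd-+ (cl⇒LeftDeadEndᴴ c) (cl⇒LeftDeadEndᴴ d)

  EndsInCl-+ : EndsInCl A G → EndsInCl A H → EndsInCl A (G +G H)
  EndsInCl-+ {G} {H} (leftG , rightG) (leftH , rightH) =
    (λ e → let eG , eH = LeftEnd-+⁻ {G} {H} e in sum (leftG eG) (leftH eH)) ,
    (λ e → let eG , eH = RightEnd-+⁻ {G} {H} e in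
           subst (cl A) (sym (conj-+G G H)) (sum (rightG eG) (rightH eH)))

  EndsInCl-conj : EndsInCl A G → EndsInCl A (conj G)
  EndsInCl-conj {⟨ GL ∣ GR ⟩} (leftG , rightG) =
    (λ e → rightG (conjs≡[]⁻ e)) ,
    (λ e → subst (cl A) (sym (conj-involutive ⟨ GL ∣ GR ⟩)) (leftG (conjs≡[]⁻ e)))

  -- The Right ends of a Left dead-end are 0, which is its own conjugate.
  mutual
    cl⇒EndsInClᴴ : cl A G → LeftDeadEndᴴ G → Hereditary (EndsInCl A) G
    cl⇒EndsInClᴴ c (hereditary refl hL hR) =
      hereditary ((λ _ → c) , λ { refl → c }) (cls⇒EndsInClᴴ (optL c) hL) (cls⇒EndsInClᴴ (optR c) hR)

    cls⇒EndsInClᴴ : (∀ {x} → x ∈ xs → cl A x) → All LeftDeadEndᴴ xs → All (Hereditary (EndsInCl A)) xs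
    cls⇒EndsInClᴴ c []       = []
    cls⇒EndsInClᴴ c (h ∷ hs) = cl⇒EndsInClᴴ (c (here refl)) h ∷ cls⇒EndsInClᴴ (c ∘ there) hs

  mutual
    𝒟⇒EndsInClᴴ : 𝒟 A G → Hereditary (EndsInCl A) G
    𝒟⇒EndsInClᴴ (base a)     = cl⇒EndsInClᴴ (base a) (LeftDeadEnd⇒ᴴ _ (A-dead _ a))
    𝒟⇒EndsInClᴴ (optL d m)   = Hereditary-optL (𝒟⇒EndsInClᴴ d) m
    𝒟⇒EndsInClᴴ (optR d m)   = Hereditary-optR (𝒟⇒EndsInClᴴ d) m
    𝒟⇒EndsInClᴴ (sum d e)    = Hereditary-+ EndsInCl-+ (𝒟⇒EndsInClᴴ d) (𝒟⇒EndsInClᴴ e)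
    𝒟⇒EndsInClᴴ (conjug d)   = Hereditary-conj EndsInCl-conj (𝒟⇒EndsInClᴴ d)
    𝒟⇒EndsInClᴴ (form ds es) = hereditary ((λ ()) , (λ ())) (𝒟s⇒EndsInClᴴ ds) (𝒟s⇒EndsInClᴴ es)

    𝒟s⇒EndsInClᴴ : All (𝒟 A) xs → All (Hereditary (EndsInCl A)) xs
    𝒟s⇒EndsInClᴴ []       = []
    𝒟s⇒EndsInClᴴ (d ∷ ds) = 𝒟⇒EndsInClᴴ d ∷ 𝒟s⇒EndsInClᴴ ds

  𝒟-LeftEnd⇒cl : 𝒟 A X → LeftEnd X → cl A X
  𝒟-LeftEnd⇒cl d = proj₁ (Hereditary-here (𝒟⇒EndsInClᴴ d))

adjLeft : Game → List Game
adjLeft ⟨ [] ∣ [] ⟩     = zeroG ∷ []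
adjLeft ⟨ [] ∣ r ∷ rs ⟩ = adjs (r ∷ rs)
adjLeft ⟨ _ ∷ _ ∣ GR ⟩  = adjs GR

adj≡ : ∀ G → adj G ≡ ⟨ adjLeft G ∣ zeroG ∷ [] ⟩
adj≡ ⟨ [] ∣ [] ⟩    = refl
adj≡ ⟨ [] ∣ _ ∷ _ ⟩ = refl
adj≡ ⟨ _ ∷ _ ∣ _ ⟩  = refl

ladj≡ : ∀ G → ladj G ≡ ⟨ adjLeft G ∣ star ∷ [] ⟩
ladj≡ ⟨ [] ∣ [] ⟩    = refl
ladj≡ ⟨ [] ∣ _ ∷ _ ⟩ = refl
ladj≡ ⟨ _ ∷ _ ∣ _ ⟩  = refl

adjs≡map : ∀ xs → adjs xs ≡ map adj xs
adjs≡map []       = refl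
adjs≡map (x ∷ xs) = cong (adj x ∷_) (adjs≡map xs)

∈-adjs⁺ : g ∈ xs → adj g ∈ adjs xs
∈-adjs⁺ {xs = xs} m rewrite adjs≡map xs = ∈-map⁺ adj m

∈-adjs⁻ : x ∈ adjs xs → ∃[ g ] g ∈ xs × x ≡ adj g
∈-adjs⁻ {xs = xs} m rewrite adjs≡map xs = ∈-map⁻ adj m

adj∈adjLeft : g ∈ GR → adj g ∈ adjLeft ⟨ GL ∣ GR ⟩
adj∈adjLeft {GR = _ ∷ _} {GL = []}    = ∈-adjs⁺
adj∈adjLeft {GR = _ ∷ _} {GL = _ ∷ _} = ∈-adjs⁺

oLeft[G+adjG]≡false : LeftDeadEndᴴ G → oLeft (G +G adj G) ≡ false
oLeft[G+adjG]≡false {G} = Game-ind (λ G → LeftDeadEndᴴ G → oLeft (G +G adj G) ≡ false) step G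
  where
  step : ∀ GL GR → All (λ G → LeftDeadEndᴴ G → oLeft (G +G adj G) ≡ false) GL
                 → All (λ G → LeftDeadEndᴴ G → oLeft (G +G adj G) ≡ false) GR
                 → LeftDeadEndᴴ ⟨ GL ∣ GR ⟩ → oLeft (⟨ GL ∣ GR ⟩ +G adj ⟨ GL ∣ GR ⟩) ≡ false
  step _ []       _ _  (hereditary refl _ _)  = refl
  step _ (r ∷ rs) _ ih (hereditary refl _ hR) = ¬-not λ won →
    case oLeft-+-true⁻ {[]} {r ∷ rs} {adjs (r ∷ rs)} {zeroG ∷ []} won of λ where
      (inj₁ (_ , ()))
      (inj₂ (inj₁ (_ , () , _)))
      (inj₂ (inj₂ (a , ma , q))) → answer (∈-adjs⁻ ma) q
    where
    answer : ∀ {a} → ∃[ g ] g ∈ r ∷ rs × a ≡ adj g → oRight (⟨ [] ∣ r ∷ rs ⟩ +G a) ≡ false → ⊥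
    answer (g , mg , refl) = not-¬ (oRight-+-moveˡ (adj g) mg (lookup ih mg (lookup hR mg)))

adjZero-loss⇒RightEnd : LeftEnd G → RightEnd G → LeftDeadEndᴴ X →
                        oLeft (adj G +G X) ≡ false → RightEnd X
adjZero-loss⇒RightEnd {⟨ [] ∣ [] ⟩} {X@(⟨ _ ∣ XR ⟩)} refl refl hX lost
  with oRight-true⁻ {R = XR} (oLeft[*+X]≡false⇒oRight {X} lost)
... | inj₁ e            = e
... | inj₂ (_ , m , q) = ⊥-elim (not-¬ (oLeft-end (Hereditary-here (Hereditary-optR hX m))) q)

adj-loss⇒reply : g ∈ GR → oLeft (adj ⟨ GL ∣ GR ⟩ +G ⟨ [] ∣ XR ⟩) ≡ false →
                 ∃[ x ] x ∈ XR × oLeft (adj g +G x) ≡ false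
adj-loss⇒reply {g} {GR} {GL} {XR} m lost
  rewrite adj≡ ⟨ GL ∣ GR ⟩
  with won ← oLeft-+-false⁻ˡ {GL = adjLeft ⟨ GL ∣ GR ⟩} {GR = zeroG ∷ []} ⟨ [] ∣ XR ⟩ lost
                             (adj∈adjLeft {GL = GL} m)
  rewrite adj≡ g
  with oRight-+-true⁻ {adjLeft g} {zeroG ∷ []} {[]} {XR} won
... | inj₁ (() , _)
... | inj₂ (inj₁ (_ , here refl , ()))
... | inj₂ (inj₂ reply) = reply

AdjointLossBound : Game → Set
AdjointLossBound G = ∀ X → LeftDeadEndᴴ G → LeftDeadEndᴴ X →
                     oLeft (adj G +G X) ≡ false → ∀ Y → (G +G Y) ⊒ (X +G Y)

adj-loss⇒⊒ : ∀ G → AdjointLossBound G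
adj-loss⇒⊒ = Game-ind AdjointLossBound outer
  where
  outer : ∀ GL GR → All AdjointLossBound GL → All AdjointLossBound GR → AdjointLossBound ⟨ GL ∣ GR ⟩
  outer _ GR _ ihG ⟨ _ ∣ XR ⟩ hG@(hereditary refl _ _) hX@(hereditary refl _ _) lost =
    Game-ind (λ Y′ → (G′ +G Y′) ⊒ (X′ +G Y′)) inner
    where
    G′ X′ : Game
    G′ = ⟨ [] ∣ GR ⟩
    X′ = ⟨ [] ∣ XR ⟩
    inner : ∀ YL YR → All (λ Y′ → (G′ +G Y′) ⊒ (X′ +G Y′)) YL → All (λ Y′ → (G′ +G Y′) ⊒ (X′ +G Y′)) YR →
            (G′ +G ⟨ YL ∣ YR ⟩) ⊒ (X′ +G ⟨ YL ∣ YR ⟩)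
    inner YL YR ihYL ihYR = leftWin , rightWin
      where
      Y′ = ⟨ YL ∣ YR ⟩
      leftWin : oLeft (X′ +G Y′) ≡ true → oLeft (G′ +G Y′) ≡ true
      leftWin won with oLeft-+-true⁻ {[]} {XR} {YL} {YR} won
      ... | inj₁ (_ , eY)             = oLeft-end (LeftEnd-+ {G′} {Y′} refl eY)
      ... | inj₂ (inj₁ (_ , () , _))
      ... | inj₂ (inj₂ (y , my , q)) = oLeft-+-moveʳ G′ my (contraposeᵇ (proj₂ (lookup ihYL my)) q)
      rightWin : oRight (G′ +G Y′) ≡ true → oRight (X′ +G Y′) ≡ true
      rightWin won with oRight-+-true⁻ {[]} {GR} {YL} {YR} won
      ... | inj₁ (eG , eY) = oRight-end (RightEnd-+ {X′} {Y′} (adjZero-loss⇒RightEnd {G′} refl eG hX lost) eY)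
      ... | inj₂ (inj₁ (g , mg , q)) =
        let x , mx , lost′ = adj-loss⇒reply {GL = []} mg lost
            g+Y⊒x+Y = lookup ihG mg x (Hereditary-optR hG mg) (Hereditary-optR hX mx) lost′ Y′
        in oRight-+-moveˡ Y′ mx (contraposeᵇ (proj₁ g+Y⊒x+Y) q)
      ... | inj₂ (inj₂ (y , my , q)) = oRight-+-moveʳ X′ my (contraposeᵇ (proj₁ (lookup ihYR my)) q)

oLeft-ignores-adjRight : ∀ L XR → oLeft (⟨ L ∣ star ∷ [] ⟩ +G ⟨ [] ∣ XR ⟩)
                                 ≡ oLeft (⟨ L ∣ zeroG ∷ [] ⟩ +G ⟨ [] ∣ XR ⟩)
oLeft-ignores-adjRight L XR = oLeft-ignoresʳ (addˡ L ⟨ [] ∣ XR ⟩ ++ []) _ _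

module _ {A : Game → Set} {L : List Game} where

  LeftStrong⇒≥0 : LeftStrong (𝒟 A) ⟨ L ∣ zeroG ∷ [] ⟩ → ⟨ L ∣ star ∷ [] ⟩ ≥[ 𝒟 A ] zeroG
  LeftStrong⇒≥0 strong X u =
    subst (λ Z → o (G⊛ +G X) ≥o o Z) (sym (+G-identityˡ X)) (from (≥o⇔⊒ (G⊛ +G X) X) (G⊛+X⊒X X u))
    where
    G⊛ = ⟨ L ∣ star ∷ [] ⟩
    G⊛+X⊒X : ∀ X → 𝒟 A X → (G⊛ +G X) ⊒ X
    G⊛+X⊒X = Game-ind (λ X → 𝒟 A X → (G⊛ +G X) ⊒ X) step
      where
      step : ∀ XL XR → All (λ X → 𝒟 A X → (G⊛ +G X) ⊒ X) XL → All (λ X → 𝒟 A X → (G⊛ +G X) ⊒ X) XR →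
             𝒟 A ⟨ XL ∣ XR ⟩ → (G⊛ +G ⟨ XL ∣ XR ⟩) ⊒ ⟨ XL ∣ XR ⟩
      step XL XR ihL ihR uX = leftWin , rightWin
        where
        leftWin : oLeft ⟨ XL ∣ XR ⟩ ≡ true → oLeft (G⊛ +G ⟨ XL ∣ XR ⟩) ≡ true
        leftWin won with oLeft-true⁻ {XL} {XR} won
        ... | inj₁ refl =
          trans (oLeft-ignores-adjRight L XR)
                (to (≥𝓝⇔oLeft (⟨ L ∣ zeroG ∷ [] ⟩ +G ⟨ [] ∣ XR ⟩)) (strong _ uX refl))
        ... | inj₂ (x , mx , q) = oLeft-+-moveʳ G⊛ mx (contraposeᵇ (proj₂ (lookup ihL mx (optL uX mx))) q)
        rightWin : oRight (G⊛ +G ⟨ XL ∣ XR ⟩) ≡ true → oRight ⟨ XL ∣ XR ⟩ ≡ true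
        rightWin won with oRight-+-true⁻ {L} {star ∷ []} {XL} {XR} won
        ... | inj₁ (() , _)
        ... | inj₂ (inj₁ (_ , here refl , q)) = oLeft[*+X]≡false⇒oRight {⟨ XL ∣ XR ⟩} q
        ... | inj₂ (inj₂ (x , mx , q)) = oRight-move mx (contraposeᵇ (proj₁ (lookup ihR mx (optR uX mx))) q)

  ≥0⇒LeftStrong : ⟨ L ∣ star ∷ [] ⟩ ≥[ 𝒟 A ] zeroG → LeftStrong (𝒟 A) ⟨ L ∣ zeroG ∷ [] ⟩
  ≥0⇒LeftStrong G⊛≥0 X@(⟨ [] ∣ XR ⟩) u refl = from (≥𝓝⇔oLeft (⟨ L ∣ zeroG ∷ [] ⟩ +G X))
    (trans (sym (oLeft-ignores-adjRight L XR))
           (proj₁ (to (≥o⇔⊒ (⟨ L ∣ star ∷ [] ⟩ +G X) (zeroG +G X)) (G⊛≥0 X u)) refl))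

module _ {A : Game → Set} (A-dead : ∀ G → A G → LeftDeadEnd G) {G : Game} (dG : LeftDeadEnd G) where

  ¬up⇒LeftStrong : ¬ up A G → LeftStrong (𝒟 A) (adj G)
  ¬up⇒LeftStrong ¬up X u eX = from (≥𝓝⇔oLeft (adj G +G X)) (¬-not λ lost →
    ¬up (dG , X , cX , λ Y _ → from (≥o⇔⊒ (G +G Y) (X +G Y))
           (adj-loss⇒⊒ G X (LeftDeadEnd⇒ᴴ G dG) (cl⇒LeftDeadEndᴴ A-dead cX) lost Y)))
    where cX = 𝒟-LeftEnd⇒cl A-dead u eX

  LeftStrong⇒¬up : LeftStrong (𝒟 A) (adj G) → ¬ up A G
  LeftStrong⇒¬up strong (_ , H , cH , G≥H) = not-¬ H+adjG-won H+adjG-lost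
    where
    H+adjG-lost : oLeft (H +G adj G) ≡ false
    H+adjG-lost = contraposeᵇ (proj₁ (to (≥o⇔⊒ (G +G adj G) (H +G adj G)) (G≥H (adj G) tt)))
                              (oLeft[G+adjG]≡false (LeftDeadEnd⇒ᴴ G dG))
    H+adjG-won : oLeft (H +G adj G) ≡ true
    H+adjG-won = trans (proj₁ (+G-outcomes-comm H (adj G)))
      (to (≥𝓝⇔oLeft (adj G +G H)) (strong H (cl⊆𝒟 cH) (Hereditary-here (cl⇒LeftDeadEndᴴ A-dead cH))))

theorem4p6 : (A : Game → Set) → (∀ G → A G → LeftDeadEnd G) →
    ∀ G → LeftDeadEnd G →
      ((¬ up A G) ⇔ LeftStrong (𝒟 A) (adj G)) ×
      (LeftStrong (𝒟 A) (adj G) ⇔ (ladj G ≥[ 𝒟 A ] zeroG))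
theorem4p6 A A-dead G dG =
  mk⇔ (¬up⇒LeftStrong A-dead dG) (LeftStrong⇒¬up A-dead dG) ,
  subst₂ (λ G° G⊛ → LeftStrong (𝒟 A) G° ⇔ (G⊛ ≥[ 𝒟 A ] zeroG)) (sym (adj≡ G)) (sym (ladj≡ G))
         (mk⇔ LeftStrong⇒≥0 ≥0⇒LeftStrong)
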